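{- The set $\{O_n : n\ge 3\}$ is first-order definable in $(\mathcal{D};\sqsubseteq)$ augmented with finitely many finite digraphs as constants.
   Context: Digraphs are pairs $(V,E)$, $V$ nonempty finite, $E\subseteq V^2$ (loops allowed); $\mathcal{D}$ is the set of their isomorphism types; $G\sqsubseteq G'$ means $G$ is isomorphic to an induced substructure of $G'$. $O_n$ ($n\ge3$) is the directed circle with vertices $v_1,\dots,v_n$ and edges $(v_1,v_2),\dots,(v_{n-1},v_n),(v_n,v_1)$. Definability means: there is a first-order formula in the language of partial orders with the constants, satisfied exactly by the elements of the set. -}

module Defs where

open import Data.Nat using (ℕ; zero; suc; _+_; _≤_; _%_; _≡ᵇ_)
open import Data.Fin using (Fin; toℕ)
open import Data.Bool using (Bool)
open import Data.Vec using (Vec; lookup)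
open import Data.Product using (Σ; _×_; ∃)
open import Data.Sum using (_⊎_)
open import Data.Empty using (⊥)
open import Relation.Binary.PropositionalEquality using (_≡_)
open import Function.Definitions using (Injective)

-- A digraph with (suc size) vertices, i.e. vertex set Fin (suc size)
-- (nonempty, finite), and an arbitrary edge relation (loops allowed).
record Digraph : Set where
  constructor mkDigraph
  field
    size : ℕ
    edge : Fin (suc size) → Fin (suc size) → Bool
open Digraph public

Vtx : Digraph → Set
Vtx G = Fin (suc (size G))

_⊑_ : Digraph → Digraph → Set
G ⊑ H = Σ (Vtx G → Vtx H) λ f →
          Injective _≡_ _≡_ f × (∀ u v → edge G u v ≡ edge H (f u) (f v))

-- Isomorphism of digraphs (equality in 𝒟, the set of isomorphism types).
_≅_ : Digraph → Digraph → Set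
G ≅ H = Σ (Vtx G → Vtx H) λ f → Σ (Vtx H → Vtx G) λ g →
          (∀ x → g (f x) ≡ x) × (∀ y → f (g y) ≡ y) ×
          (∀ u v → edge G u v ≡ edge H (f u) (f v))

-- circle m : the directed circle on suc m vertices 0,…,m with edges
-- (i, i+1 mod (suc m)).  O_n (n ≥ 3) is circle (n - 1), i.e. m ≥ 2.
circle : ℕ → Digraph
circle m = mkDigraph m (λ u v → (suc (toℕ u) % suc m) ≡ᵇ toℕ v)

IsO : Digraph → Set
IsO G = Σ ℕ λ m → 2 ≤ m × G ≅ circle m

-- First-order logic in the language of partial orders {⊑} (with equality)
-- with k constant symbols, formulas with n free variables (de Bruijn).
data Term (k n : ℕ) : Set where
  var : Fin n → Term k n
  con : Fin k → Term k n

data Formula (k : ℕ) : ℕ → Set where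
  ⊑' : ∀ {n} → Term k n → Term k n → Formula k n
  ≐' : ∀ {n} → Term k n → Term k n → Formula k n
  ⊥' : ∀ {n} → Formula k n
  ¬' : ∀ {n} → Formula k n → Formula k n
  ∧' : ∀ {n} → Formula k n → Formula k n → Formula k n
  ∨' : ∀ {n} → Formula k n → Formula k n → Formula k n
  ⇒' : ∀ {n} → Formula k n → Formula k n → Formula k n
  ∀' : ∀ {n} → Formula k (suc n) → Formula k n
  ∃' : ∀ {n} → Formula k (suc n) → Formula k n

evalT : ∀ {k n} → Vec Digraph k → Vec Digraph n → Term k n → Digraph
evalT cs ρ (var i) = lookup ρ i
evalT cs ρ (con j) = lookup cs j

-- Tarskian satisfaction in (𝒟; ⊑) with constants cs; equality of
-- isomorphism types is isomorphism; quantifiers range over all digraphs.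
Sat : ∀ {k n} → Vec Digraph k → Formula k n → Vec Digraph n → Set
Sat cs (⊑' s t) ρ = evalT cs ρ s ⊑ evalT cs ρ t
Sat cs (≐' s t) ρ = evalT cs ρ s ≅ evalT cs ρ t
Sat cs ⊥' ρ = ⊥
Sat cs (¬' φ) ρ = Sat cs φ ρ → ⊥
Sat cs (∧' φ ψ) ρ = Sat cs φ ρ × Sat cs ψ ρ
Sat cs (∨' φ ψ) ρ = Sat cs φ ρ ⊎ Sat cs ψ ρ
Sat cs (⇒' φ ψ) ρ = Sat cs φ ρ → Sat cs ψ ρ
Sat cs (∀' φ) ρ = ∀ (G : Digraph) → Sat cs φ (G Data.Vec.∷ ρ)
Sat cs (∃' φ) ρ = Σ Digraph λ G → Sat cs φ (G Data.Vec.∷ ρ)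

module Submission where

-- The circles O_n (n ≥ 3) are first-order definable in (𝒟; ⊑) with finitely
-- many constants, namely all digraphs on at most three vertices.
--
-- With these constants the class of disjoint unions of directed paths and
-- cycles (loopless, no 2-cycles, in- and out-degree ≤ 1) is definable: a
-- digraph belongs to it iff all its induced subgraphs on ≤ 3 vertices do.
-- Write Y for a cover of G if Y is an immediate successor of G under ⊑.  The
-- formula says of x: x lies in the class, x has up to ≅ a unique cover in the
-- class, and x is ⊑-minimal with this uniqueness property.
--   * O_n satisfies it: its only such cover is O_n plus an isolated vertex,
--     and a sinkless substructure of O_n is all of O_n.
--   * Conversely, if x satisfies it then x has no sink t (attaching a new
--     vertex below t, or an isolated one, would give two covers with different
--     edge counts), so walking along out-edges closes a circle O_n ⊑ x; O_n has
--     a unique cover too, hence x ≅ O_n by minimality.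

open import Defs
open import Data.Nat using (ℕ)
open import Data.Vec using (Vec; _∷_; [])
open import Data.Product using (Σ)
open import Function.Bundles using (_⇔_)

open import Data.Nat using (zero; suc; _+_; _*_; _^_; _≤_; _<_; _%_; _/_; _∸_; z≤n; s≤s; s≤s⁻¹; s<s⁻¹; NonZero)
open import Data.Nat.Properties as NP using ()
open import Data.Nat.DivMod using (m%n<n; n%n≡0; m≡m%n+[m/n]*n; m%n%n≡m%n; %-distribˡ-+; [m+n]%n≡m%n; m<n⇒m%n≡m)
open import Data.Nat.Divisibility using (_∣_; divides; >⇒∤)
open import Data.Nat.GeneralisedArithmetic using (fold; fold-+)
open import Data.Fin using (Fin; toℕ; fromℕ<; combine; remQuot; finToFun; funToFin; _↑ˡ_; _↑ʳ_; punchOut)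
  renaming (zero to fz; suc to fs)
open import Data.Fin.Properties as FP using ()
open import Data.Fin.Patterns using (0F; 1F; 2F)
open import Data.Fin.Permutation using (permutation)
open import Data.Bool using (Bool; true; false; if_then_else_)
open import Data.Bool.Properties as BP using ()
open import Data.Product using (_×_; _,_; proj₁; proj₂; ∃; uncurry)
open import Data.Sum using (_⊎_; inj₁; inj₂)
open import Data.Empty using (⊥; ⊥-elim)
open import Data.Vec using (lookup; tabulate; _++_)
open import Data.Vec.Properties using (lookup-++ˡ; lookup-++ʳ; lookup∘tabulate)
open import Relation.Nullary using (¬_; Dec; yes; no; does; ¬?; _×-dec_; _→-dec_)
open import Relation.Nullary.Decidable using (map′)
open import Relation.Binary.PropositionalEquality
open import Relation.Binary.Definitions using (tri<; tri≈; tri>)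
open import Function.Base using (_∘_)
open import Function.Definitions using (Injective)
open import Function.Bundles using (mk⇔; Equivalence)
open import Algebra.Properties.CommutativeMonoid.Sum NP.+-0-commutativeMonoid
  using (sum; sum-permute; sum-cong-≗; ∑-distrib-+; sum-replicate-zero)
open import Function.Properties.Equivalence using () renaming (trans to ⇔-trans)

open Equivalence using (to; from)

⊑-trans : ∀ {G H K} → G ⊑ H → H ⊑ K → G ⊑ K
⊑-trans (f , f-inj , f-edge) (g , g-inj , g-edge) =
  g ∘ f , f-inj ∘ g-inj , λ u v → trans (f-edge u v) (g-edge (f u) (f v))

≅⇒⊑ : ∀ {G H} → G ≅ H → G ⊑ H
≅⇒⊑ (f , g , gf , _ , f-edge) = f , (λ {x} {y} e → trans (sym (gf x)) (trans (cong g e) (gf y))) , f-edge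

≅⇒⊒ : ∀ {G H} → G ≅ H → H ⊑ G
≅⇒⊒ {G} {H} (f , g , gf , fg , f-edge) = g , (λ {x} {y} e → trans (sym (fg x)) (trans (cong f e) (fg y))) , λ u v →
  trans (cong₂ (edge H) (sym (fg u)) (sym (fg v))) (sym (f-edge (g u) (g v)))

≅-sym : ∀ {G H} → G ≅ H → H ≅ G
≅-sym {G} {H} (f , g , gf , fg , f-edge) = g , f , fg , gf , λ u v →
  trans (cong₂ (edge H) (sym (fg u)) (sym (fg v))) (sym (f-edge (g u) (g v)))

≅-trans : ∀ {G H K} → G ≅ H → H ≅ K → G ≅ K
≅-trans (f , g , gf , fg , f-edge) (f' , g' , gf' , fg' , f'-edge) =
  f' ∘ f , g ∘ g' , (λ x → trans (cong g (gf' (f x))) (gf x)) ,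
  (λ x → trans (cong f' (fg (g' x))) (fg' x)) , λ u v → trans (f-edge u v) (f'-edge (f u) (f v))

⊑⇒size≤ : ∀ {G H} → G ⊑ H → size G ≤ size H
⊑⇒size≤ (_ , f-inj , _) = NP.≤-pred (FP.injective⇒≤ f-inj)

surjective⊎missing : ∀ {m n} (f : Fin m → Fin n) → (∀ y → ∃ λ x → f x ≡ y) ⊎ (∃ λ y → ∀ x → f x ≢ y)
surjective⊎missing {m} {n} f with FP.all? (λ y → FP.any? (λ x → f x FP.≟ y))
... | yes onto = inj₁ onto
... | no ¬onto with FP.¬∀⟶∃¬ n _ (λ y → FP.any? (λ x → f x FP.≟ y)) ¬onto
...   | y , missed = inj₂ (y , λ x e → missed (x , e))

-- Pigeonhole in the converse direction: an injection into a set that is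
-- not larger is onto (otherwise it would inject into one point less).
injective⇒surjective : ∀ {m n} (f : Fin m → Fin n) → Injective _≡_ _≡_ f → n ≤ m → ∀ y → ∃ λ x → f x ≡ y
injective⇒surjective {m} {suc n} f f-inj n≤m with surjective⊎missing f
... | inj₁ onto = onto
... | inj₂ (y , missed) = ⊥-elim (NP.<⇒≱ (s≤s (FP.injective⇒≤ squeezed-inj)) n≤m)
  where
  squeezed : Fin m → Fin n
  squeezed x = punchOut (missed x ∘ sym)
  squeezed-inj : Injective _≡_ _≡_ squeezed
  squeezed-inj {x} {x'} e = f-inj (FP.punchOut-injective (missed x ∘ sym) (missed x' ∘ sym) e)

surjective-⊑⇒≅ : ∀ {G H} (e : G ⊑ H) → (∀ y → ∃ λ x → proj₁ e x ≡ y) → G ≅ H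
surjective-⊑⇒≅ {G} {H} (f , f-inj , f-edge) onto = f , g , (λ x → f-inj (fg (f x))) , fg , f-edge
  where
  g : Vtx H → Vtx G
  g y = proj₁ (onto y)
  fg : ∀ y → f (g y) ≡ y
  fg y = proj₂ (onto y)

⊑-size⇒≅ : ∀ {G H} → G ⊑ H → size H ≤ size G → G ≅ H
⊑-size⇒≅ {G} {H} (f , f-inj , f-edge) H≤G =
  surjective-⊑⇒≅ {G} {H} (f , f-inj , f-edge) (injective⇒surjective f f-inj (s≤s H≤G))

restrict : (G : Digraph) {k : ℕ} → (Fin (suc k) → Vtx G) → Digraph
restrict G {k} m = mkDigraph k (λ u v → edge G (m u) (m v))

restrict-⊑ : ∀ G {k} (m : Fin (suc k) → Vtx G) → Injective _≡_ _≡_ m → restrict G m ⊑ G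
restrict-⊑ G m m-inj = m , m-inj , λ u v → refl

bit : Fin 2 → Bool
bit 0F = false
bit 1F = true

bitCode : Bool → Fin 2
bitCode false = 0F
bitCode true = 1F

decode : ∀ k → Fin (2 ^ (suc k * suc k)) → Digraph
decode k c = mkDigraph k (λ u v → bit (finToFun c (combine u v)))

adjacency : (G : Digraph) → Fin (suc (size G) * suc (size G)) → Fin 2
adjacency G i = bitCode (uncurry (edge G) (remQuot (suc (size G)) i))

encode : (G : Digraph) → Fin (2 ^ (suc (size G) * suc (size G)))
encode G = funToFin (adjacency G)

decode-encode : ∀ G → decode (size G) (encode G) ≅ G
decode-encode G = (λ x → x) , (λ x → x) , (λ _ → refl) , (λ _ → refl) , decoded-edge
  where
  bit-bitCode : ∀ b → bit (bitCode b) ≡ b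
  bit-bitCode false = refl
  bit-bitCode true = refl
  decoded-edge : ∀ u v → edge (decode (size G) (encode G)) u v ≡ edge G u v
  decoded-edge u v = begin
    bit (finToFun (funToFin (adjacency G)) (combine u v))  ≡⟨ cong bit (FP.finToFun-funToFin (adjacency G) (combine u v)) ⟩
    bit (adjacency G (combine u v))                ≡⟨ cong (λ p → bit (bitCode (uncurry (edge G) p))) (FP.remQuot-combine u v) ⟩
    bit (bitCode (edge G u v))                     ≡⟨ bit-bitCode (edge G u v) ⟩
    edge G u v                                     ∎
    where open ≡-Reasoning

-- The constants: all digraphs on one, two and three vertices, listed by code.
-- They are kept abstract, since only their completeness is used and
-- unfolding the 530-element vector slows type checking down considerably.
abstract
  smallCount : ℕ
  smallCount = 2 ^ (1 * 1) + (2 ^ (2 * 2) + 2 ^ (3 * 3))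

  codes : ∀ k → Vec Digraph (2 ^ (suc k * suc k))
  codes k = tabulate (decode k)

  smallDigraphs : Vec Digraph smallCount
  smallDigraphs = codes 0 ++ (codes 1 ++ codes 2)

  located : ∀ {G} j → lookup smallDigraphs j ≡ decode (size G) (encode G) →
            Σ (Fin smallCount) λ j → lookup smallDigraphs j ≅ G
  located {G} j eq = j , subst (_≅ G) (sym eq) (decode-encode G)

  smallDigraphs-complete : ∀ G → size G ≤ 2 → Σ (Fin smallCount) λ j → lookup smallDigraphs j ≅ G
  smallDigraphs-complete G@(mkDigraph 0 _) _ = located {G} (encode G ↑ˡ (2 ^ (2 * 2) + 2 ^ (3 * 3))) (begin
    lookup smallDigraphs (encode G ↑ˡ _)  ≡⟨ lookup-++ˡ (codes 0) (codes 1 ++ codes 2) (encode G) ⟩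
    lookup (codes 0) (encode G)           ≡⟨ lookup∘tabulate (decode 0) (encode G) ⟩
    decode 0 (encode G)                   ∎)
    where open ≡-Reasoning
  smallDigraphs-complete G@(mkDigraph 1 _) _ = located {G} (2 ↑ʳ (encode G ↑ˡ 2 ^ (3 * 3))) (begin
    lookup smallDigraphs (2 ↑ʳ (encode G ↑ˡ _))    ≡⟨ lookup-++ʳ (codes 0) (codes 1 ++ codes 2) (encode G ↑ˡ _) ⟩
    lookup (codes 1 ++ codes 2) (encode G ↑ˡ _)     ≡⟨ lookup-++ˡ (codes 1) (codes 2) (encode G) ⟩
    lookup (codes 1) (encode G)                     ≡⟨ lookup∘tabulate (decode 1) (encode G) ⟩
    decode 1 (encode G)                             ∎)
    where open ≡-Reasoning
  smallDigraphs-complete G@(mkDigraph 2 _) _ = located {G} (2 ↑ʳ (16 ↑ʳ encode G)) (begin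
    lookup smallDigraphs (2 ↑ʳ (16 ↑ʳ encode G))   ≡⟨ lookup-++ʳ (codes 0) (codes 1 ++ codes 2) (16 ↑ʳ encode G) ⟩
    lookup (codes 1 ++ codes 2) (16 ↑ʳ encode G)    ≡⟨ lookup-++ʳ (codes 1) (codes 2) (encode G) ⟩
    lookup (codes 2) (encode G)                     ≡⟨ lookup∘tabulate (decode 2) (encode G) ⟩
    decode 2 (encode G)                             ∎)
    where open ≡-Reasoning
  smallDigraphs-complete (mkDigraph (suc (suc (suc _))) _) (s≤s (s≤s ()))

-- Loopless, without 2-cycles, and of in- and out-degree at most one: the
-- digraphs that are disjoint unions of directed paths and circles O_n.
record PathsAndCycles (G : Digraph) : Set where
  field
    loopless   : ∀ a → edge G a a ≡ false
    asymmetric : ∀ a b → edge G a b ≡ true → edge G b a ≡ false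
    out≤1      : ∀ a b c → edge G a b ≡ true → edge G a c ≡ true → b ≡ c
    in≤1       : ∀ a b c → edge G b a ≡ true → edge G c a ≡ true → b ≡ c

pathsAndCycles-⊑ : ∀ {H G} → H ⊑ G → PathsAndCycles G → PathsAndCycles H
pathsAndCycles-⊑ (f , f-inj , f-edge) pc = record
  { loopless   = λ a → trans (f-edge a a) (loopless (f a))
  ; asymmetric = λ a b e → trans (f-edge b a) (asymmetric (f a) (f b) (trans (sym (f-edge a b)) e))
  ; out≤1      = λ a b c e₁ e₂ → f-inj (out≤1 (f a) (f b) (f c) (trans (sym (f-edge a b)) e₁) (trans (sym (f-edge a c)) e₂))
  ; in≤1       = λ a b c e₁ e₂ → f-inj (in≤1 (f a) (f b) (f c) (trans (sym (f-edge b a)) e₁) (trans (sym (f-edge c a)) e₂))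
  }
  where open PathsAndCycles pc

-- The class is decidable (all quantifiers range over finite sets).  The
-- decision procedure is kept abstract so that formulas built from it are
-- not unfolded during type checking.
abstract
  pathsAndCycles? : ∀ G → Dec (PathsAndCycles G)
  pathsAndCycles? G =
    map′ (λ (l , s , o , i) → record { loopless = l ; asymmetric = s ; out≤1 = o ; in≤1 = i })
         (λ pc → let open PathsAndCycles pc in loopless , asymmetric , out≤1 , in≤1)
         (FP.all? (λ a → edge G a a BP.≟ false)
         ×-dec FP.all? (λ a → FP.all? λ b → (edge G a b BP.≟ true) →-dec (edge G b a BP.≟ false))
         ×-dec FP.all? (λ a → FP.all? λ b → FP.all? λ c →
                 (edge G a b BP.≟ true) →-dec (edge G a c BP.≟ true) →-dec (b FP.≟ c))
         ×-dec FP.all? (λ a → FP.all? λ b → FP.all? λ c →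
                 (edge G b a BP.≟ true) →-dec (edge G c a BP.≟ true) →-dec (b FP.≟ c)))

pair-injective : ∀ {A : Set} {a b : A} → a ≢ b → Injective _≡_ _≡_ (lookup (a ∷ b ∷ []))
pair-injective a≢b {0F} {0F} _ = refl
pair-injective a≢b {0F} {1F} e = ⊥-elim (a≢b e)
pair-injective a≢b {1F} {0F} e = ⊥-elim (a≢b (sym e))
pair-injective a≢b {1F} {1F} _ = refl

triple-injective : ∀ {A : Set} {a b c : A} → a ≢ b → a ≢ c → b ≢ c → Injective _≡_ _≡_ (lookup (a ∷ b ∷ c ∷ []))
triple-injective a≢b a≢c b≢c {0F} {0F} _ = refl
triple-injective a≢b a≢c b≢c {0F} {1F} e = ⊥-elim (a≢b e)
triple-injective a≢b a≢c b≢c {0F} {2F} e = ⊥-elim (a≢c e)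
triple-injective a≢b a≢c b≢c {1F} {0F} e = ⊥-elim (a≢b (sym e))
triple-injective a≢b a≢c b≢c {1F} {1F} _ = refl
triple-injective a≢b a≢c b≢c {1F} {2F} e = ⊥-elim (b≢c e)
triple-injective a≢b a≢c b≢c {2F} {0F} e = ⊥-elim (a≢c (sym e))
triple-injective a≢b a≢c b≢c {2F} {1F} e = ⊥-elim (b≢c (sym e))
triple-injective a≢b a≢c b≢c {2F} {2F} _ = refl

local⇒pathsAndCycles : ∀ G →
  (∀ {k} (m : Fin (suc k) → Vtx G) → k ≤ 2 → Injective _≡_ _≡_ m → PathsAndCycles (restrict G m)) →
  PathsAndCycles G
local⇒pathsAndCycles G local = record
  { loopless = loopless ; asymmetric = asymmetric ; out≤1 = out≤1 ; in≤1 = in≤1 }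
  where
  onPair : ∀ {a b} → a ≢ b → PathsAndCycles (restrict G (lookup (a ∷ b ∷ [])))
  onPair a≢b = local _ (s≤s z≤n) (pair-injective a≢b)
  onTriple : ∀ {a b c} → a ≢ b → a ≢ c → b ≢ c → PathsAndCycles (restrict G (lookup (a ∷ b ∷ c ∷ [])))
  onTriple a≢b a≢c b≢c = local _ (s≤s (s≤s z≤n)) (triple-injective a≢b a≢c b≢c)

  loopless : ∀ a → edge G a a ≡ false
  loopless a = PathsAndCycles.loopless (local (λ _ → a) z≤n (λ { {fz} {fz} _ → refl })) 0F
  edge⇒≢ : ∀ {a b} → edge G a b ≡ true → a ≢ b
  edge⇒≢ {a} e refl with () ← trans (sym e) (loopless a)

  asymmetric : ∀ a b → edge G a b ≡ true → edge G b a ≡ false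
  asymmetric a b e = PathsAndCycles.asymmetric (onPair (edge⇒≢ e)) 0F 1F e
  out≤1 : ∀ a b c → edge G a b ≡ true → edge G a c ≡ true → b ≡ c
  out≤1 a b c e₁ e₂ with b FP.≟ c
  ... | yes b≡c = b≡c
  ... | no b≢c with () ← PathsAndCycles.out≤1 (onTriple (edge⇒≢ e₁) (edge⇒≢ e₂) b≢c) 0F 1F 2F e₁ e₂
  in≤1 : ∀ a b c → edge G b a ≡ true → edge G c a ≡ true → b ≡ c
  in≤1 a b c e₁ e₂ with b FP.≟ c
  ... | yes b≡c = b≡c
  ... | no b≢c with () ← PathsAndCycles.in≤1 (onTriple (edge⇒≢ e₁ ∘ sym) (edge⇒≢ e₂ ∘ sym) b≢c) 0F 1F 2F e₁ e₂

-- G contains no copy of a small digraph outside the class; this is the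
-- first-order (in fact universal) description of the class.
Avoids : Digraph → Set
Avoids G = ∀ j → ¬ PathsAndCycles (lookup smallDigraphs j) → ¬ (lookup smallDigraphs j ⊑ G)

pathsAndCycles⇔avoids : ∀ G → PathsAndCycles G ⇔ Avoids G
pathsAndCycles⇔avoids G = mk⇔
  (λ pc j bad j⊑G → bad (pathsAndCycles-⊑ {lookup smallDigraphs j} {G} j⊑G pc))
  (λ avoids → local⇒pathsAndCycles G λ m k≤2 m-inj → smallInduced avoids (restrict-⊑ G m m-inj) k≤2)
  where
  smallInduced : ∀ {H} → Avoids G → H ⊑ G → size H ≤ 2 → PathsAndCycles H
  smallInduced {H} avoids H⊑G small with smallDigraphs-complete H small
  ... | j , j≅H with pathsAndCycles? (lookup smallDigraphs j)
  ...   | yes pc = pathsAndCycles-⊑ {H} {lookup smallDigraphs j} (≅⇒⊒ {lookup smallDigraphs j} {H} j≅H) pc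
  ...   | no bad = ⊥-elim (avoids j bad (⊑-trans {lookup smallDigraphs j} {H} {G} (≅⇒⊑ {lookup smallDigraphs j} {H} j≅H) H⊑G))

Covers : Digraph → Digraph → Set
Covers G H = G ⊑ H × ¬ (H ⊑ G) × (∀ K → G ⊑ K → K ⊑ H → K ⊑ G ⊎ H ⊑ K)

covers-by-size : ∀ {G H} → G ⊑ H → size H ≡ suc (size G) → Covers G H
covers-by-size {G} {H} G⊑H grows = G⊑H , (λ H⊑G → NP.1+n≰n (subst (_≤ size G) grows (⊑⇒size≤ {H} {G} H⊑G))) , between
  where
  between : ∀ K → G ⊑ K → K ⊑ H → K ⊑ G ⊎ H ⊑ K
  between K G⊑K K⊑H with size K NP.≤? size G
  ... | yes K≤G = inj₁ (≅⇒⊒ {G} {K} (⊑-size⇒≅ {G} {K} G⊑K K≤G))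
  ... | no K≰G = inj₂ (≅⇒⊒ {K} {H} (⊑-size⇒≅ {K} {H} K⊑H (subst (_≤ size K) (sym grows) (NP.≰⇒> K≰G))))

covers-≅ : ∀ {A A' Y} → A ≅ A' → Covers A Y → Covers A' Y
covers-≅ {A} {A'} {Y} A≅A' (A⊑Y , Y⋢A , between) =
  ⊑-trans {A'} {A} {Y} A'⊑A A⊑Y , (λ Y⊑A' → Y⋢A (⊑-trans {Y} {A'} {A} Y⊑A' A'⊑A)) , between'
  where
  A⊑A' : A ⊑ A'
  A⊑A' = ≅⇒⊑ {A} {A'} A≅A'
  A'⊑A : A' ⊑ A
  A'⊑A = ≅⇒⊒ {A} {A'} A≅A'
  between' : ∀ K → A' ⊑ K → K ⊑ Y → K ⊑ A' ⊎ Y ⊑ K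
  between' K A'⊑K K⊑Y with between K (⊑-trans {A} {A'} {K} A⊑A' A'⊑K) K⊑Y
  ... | inj₁ K⊑A = inj₁ (⊑-trans {K} {A} {A'} K⊑A A⊑A')
  ... | inj₂ Y⊑K = inj₂ Y⊑K

UniqueCover : Digraph → Set
UniqueCover G = ∀ Y Z → PathsAndCycles Y → PathsAndCycles Z → Covers G Y → Covers G Z → Y ≅ Z

uniqueCover-≅ : ∀ {A A'} → A ≅ A' → UniqueCover A → UniqueCover A'
uniqueCover-≅ {A} {A'} A≅A' unique Y Z pcY pcZ covY covZ =
  unique Y Z pcY pcZ (covers-≅ {A'} {A} {Y} A'≅A covY) (covers-≅ {A'} {A} {Z} A'≅A covZ)
  where
  A'≅A : A' ≅ A
  A'≅A = ≅-sym {A} {A'} A≅A'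

extend : (G : Digraph) → (Vtx G → Bool) → Digraph
extend G inE = mkDigraph (suc (size G)) extended
  where
  extended : Fin (suc (suc (size G))) → Fin (suc (suc (size G))) → Bool
  extended fz     _      = false
  extended (fs u) fz     = inE u
  extended (fs u) (fs v) = edge G u v

extend-covers : ∀ G inE → Covers G (extend G inE)
extend-covers G inE = covers-by-size {G} {extend G inE} (fs , FP.suc-injective , λ u v → refl) refl

extend-pathsAndCycles : ∀ G inE → PathsAndCycles G →
  (∀ u → inE u ≡ true → ∀ v → edge G u v ≡ false) → (∀ u u' → inE u ≡ true → inE u' ≡ true → u ≡ u') →
  PathsAndCycles (extend G inE)
extend-pathsAndCycles G inE pc sink unique = record
  { loopless = loopless' ; asymmetric = asymmetric' ; out≤1 = out≤1' ; in≤1 = in≤1' }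
  where
  open PathsAndCycles pc
  X : Digraph
  X = extend G inE
  only : ∀ u v → inE u ≡ true → edge G u v ≡ true → ⊥
  only u v e₁ e₂ with () ← trans (sym e₂) (sink u e₁ v)
  loopless' : ∀ a → edge X a a ≡ false
  loopless' fz     = refl
  loopless' (fs a) = loopless a
  asymmetric' : ∀ a b → edge X a b ≡ true → edge X b a ≡ false
  asymmetric' (fs a) fz     _ = refl
  asymmetric' (fs a) (fs b) e = asymmetric a b e
  out≤1' : ∀ a b c → edge X a b ≡ true → edge X a c ≡ true → b ≡ c
  out≤1' (fs a) fz     fz     _  _  = refl
  out≤1' (fs a) fz     (fs c) e₁ e₂ = ⊥-elim (only a c e₁ e₂)
  out≤1' (fs a) (fs b) fz     e₁ e₂ = ⊥-elim (only a b e₂ e₁)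
  out≤1' (fs a) (fs b) (fs c) e₁ e₂ = cong fs (out≤1 a b c e₁ e₂)
  in≤1' : ∀ a b c → edge X b a ≡ true → edge X c a ≡ true → b ≡ c
  in≤1' fz     (fs b) (fs c) e₁ e₂ = cong fs (unique b c e₁ e₂)
  in≤1' (fs a) (fs b) (fs c) e₁ e₂ = cong fs (in≤1 a b c e₁ e₂)

indicator : Bool → ℕ
indicator b = if b then 1 else 0

edgeCount : Digraph → ℕ
edgeCount G = sum λ u → sum λ v → indicator (edge G u v)

sum-reindex : ∀ {m n} (f : Fin m → Fin n) (g : Fin n → Fin m) → (∀ y → f (g y) ≡ y) → (∀ x → g (f x) ≡ x) →
  (F : Fin n → ℕ) → sum F ≡ sum (F ∘ f)
sum-reindex f g fg gf F = sum-permute F (permutation f g fg gf)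

edgeCount-≅ : ∀ {G H} → G ≅ H → edgeCount H ≡ edgeCount G
edgeCount-≅ {G} {H} (f , g , gf , fg , f-edge) =
  trans (sum-reindex f g fg gf (λ u → sum λ v → indicator (edge H u v)))
    (sum-cong-≗ λ u → trans (sum-reindex f g fg gf (λ v → indicator (edge H (f u) v)))
                            (sum-cong-≗ λ v → cong indicator (sym (f-edge u v))))

edgeCount-extend : ∀ G inE → edgeCount (extend G inE) ≡ sum (indicator ∘ inE) + edgeCount G
edgeCount-extend G inE = begin
  sum (λ (_ : Fin (suc (suc (size G)))) → 0) + sum (λ u → indicator (inE u) + out u)
      ≡⟨ cong (_+ sum (λ u → indicator (inE u) + out u)) (sum-replicate-zero (suc (suc (size G)))) ⟩
  sum (λ u → indicator (inE u) + out u)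
      ≡⟨ ∑-distrib-+ (indicator ∘ inE) out ⟩
  sum (indicator ∘ inE) + edgeCount G ∎
  where
  open ≡-Reasoning
  out : Vtx G → ℕ
  out u = sum λ v → indicator (edge G u v)

sum-point : ∀ {n} (t : Fin n) → sum (λ u → indicator (does (u FP.≟ t))) ≡ 1
sum-point {suc n} fz     = cong suc (sum-replicate-zero n)
sum-point {suc n} (fs t) = sum-point t

Sinkless : Digraph → Set
Sinkless G = ∀ v → ∃ λ w → edge G v w ≡ true

-- A union of paths and cycles with a unique cover has no sink t: otherwise
-- attaching a new vertex below t, or an isolated new vertex, gives two such
-- covers with different numbers of edges.
uniqueCover⇒sinkless : ∀ G → PathsAndCycles G → UniqueCover G → Sinkless G
uniqueCover⇒sinkless G pc unique t with FP.any? (λ v → edge G t v BP.≟ true)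
... | yes out = out
... | no sink = ⊥-elim (NP.1+n≢n (begin
  suc (edgeCount G)                            ≡⟨ cong (_+ edgeCount G) (sum-point t) ⟨
  sum (indicator ∘ below) + edgeCount G        ≡⟨ edgeCount-extend G below ⟨
  edgeCount (extend G below)                   ≡⟨ edgeCount-≅ {extend G isolated} {extend G below} isolated≅below ⟩
  edgeCount (extend G isolated)                ≡⟨ edgeCount-extend G isolated ⟩
  sum (indicator ∘ isolated) + edgeCount G     ≡⟨ cong (_+ edgeCount G) (sum-replicate-zero (suc (size G))) ⟩
  edgeCount G                                  ∎))
  where
  open ≡-Reasoning
  below isolated : Vtx G → Bool
  below u = does (u FP.≟ t)
  isolated _ = false
  at-t : ∀ {u} → below u ≡ true → u ≡ t
  at-t {u} e with u FP.≟ t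
  ... | yes u≡t = u≡t
  ... | no _ with () ← e
  t-sink : ∀ v → edge G t v ≡ false
  t-sink v = BP.¬-not (λ e → sink (v , e))
  isolated≅below : extend G isolated ≅ extend G below
  isolated≅below = unique _ _
    (extend-pathsAndCycles G isolated pc (λ _ ()) (λ _ _ ()))
    (extend-pathsAndCycles G below pc (λ u e v → subst (λ x → edge G x v ≡ false) (sym (at-t e)) (t-sink v))
                                      (λ u u' e e' → trans (at-t e) (sym (at-t e'))))
    (extend-covers G isolated) (extend-covers G below)

next : ∀ {m} → Fin (suc m) → Fin (suc m)
next {m} i = fromℕ< (m%n<n (suc (toℕ i)) (suc m))

toℕ-next : ∀ {m} (i : Fin (suc m)) → toℕ (next i) ≡ suc (toℕ i) % suc m
toℕ-next {m} i = FP.toℕ-fromℕ< (m%n<n (suc (toℕ i)) (suc m))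

FunctionalVia : (G : Digraph) → (Vtx G → Vtx G) → Set
FunctionalVia G s = ∀ u v → edge G u v ≡ true ⇔ v ≡ s u

circle-functional : ∀ m → FunctionalVia (circle m) next
circle-functional m i j = mk⇔
  (λ e → FP.toℕ-injective (trans (sym (NP.≡ᵇ⇒≡ _ _ (from BP.T-≡ e))) (sym (toℕ-next i))))
  (λ { refl → to BP.T-≡ (NP.≡⇒≡ᵇ _ _ (sym (toℕ-next i))) })

intertwining⇒⊑ : ∀ {H G} {s : Vtx H → Vtx H} {t : Vtx G → Vtx G} → FunctionalVia H s → FunctionalVia G t →
  (h : Vtx H → Vtx G) → Injective _≡_ _≡_ h → (∀ v → h (s v) ≡ t (h v)) → H ⊑ G
intertwining⇒⊑ {s = s} {t} H-fun G-fun h h-inj h-step = h , h-inj , λ u v → BP.⇔→≡ (mk⇔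
  (λ e → from (G-fun (h u) (h v)) (trans (cong h (to (H-fun u v) e)) (h-step u)))
  (λ e → from (H-fun u v) (h-inj (trans (to (G-fun (h u) (h v)) e) (sym (h-step u))))))

suc-% : ∀ x n .{{_ : NonZero n}} → suc (x % n) % n ≡ suc x % n
suc-% x n = begin
  (1 + x % n) % n           ≡⟨ %-distribˡ-+ 1 (x % n) n ⟩
  (1 % n + x % n % n) % n   ≡⟨ cong (λ y → (1 % n + y) % n) (m%n%n≡m%n x n) ⟩
  (1 % n + x % n) % n       ≡⟨ %-distribˡ-+ 1 x n ⟨
  (1 + x) % n               ∎
  where open ≡-Reasoning

toℕ-steps : ∀ {m} k (a : Fin (suc m)) → toℕ (fold a next k) ≡ (toℕ a + k) % suc m
toℕ-steps {m} zero a = begin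
  toℕ a                 ≡⟨ m<n⇒m%n≡m (FP.toℕ<n a) ⟨
  toℕ a % suc m         ≡⟨ cong (_% suc m) (NP.+-identityʳ (toℕ a)) ⟨
  (toℕ a + 0) % suc m   ∎
  where open ≡-Reasoning
toℕ-steps {m} (suc k) a = begin
  toℕ (next (fold a next k))       ≡⟨ toℕ-next (fold a next k) ⟩
  suc (toℕ (fold a next k)) % suc m ≡⟨ cong (λ x → suc x % suc m) (toℕ-steps k a) ⟩
  suc ((toℕ a + k) % suc m) % suc m ≡⟨ suc-% (toℕ a + k) (suc m) ⟩
  suc (toℕ a + k) % suc m          ≡⟨ cong (_% suc m) (NP.+-suc (toℕ a) k) ⟨
  (toℕ a + suc k) % suc m          ∎
  where open ≡-Reasoning

steps-around : ∀ {m} (a : Fin (suc m)) → fold a next (suc m) ≡ a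
steps-around {m} a = FP.toℕ-injective (begin
  toℕ (fold a next (suc m))   ≡⟨ toℕ-steps (suc m) a ⟩
  (toℕ a + suc m) % suc m     ≡⟨ [m+n]%n≡m%n (toℕ a) (suc m) ⟩
  toℕ a % suc m               ≡⟨ m<n⇒m%n≡m (FP.toℕ<n a) ⟩
  toℕ a                       ∎)
  where open ≡-Reasoning

-- The predecessor on the circle: m steps forward are one step back.
prev : ∀ {m} → Fin (suc m) → Fin (suc m)
prev {m} a = fold a next m

next-prev : ∀ {m} (a : Fin (suc m)) → next (prev a) ≡ a
next-prev = steps-around

prev-next : ∀ {m} (a : Fin (suc m)) → prev (next a) ≡ a
prev-next {m} a = begin
  fold (next a) next m    ≡⟨ fold-+ a next m {1} ⟨
  fold a next (m + 1)     ≡⟨ cong (fold a next) (NP.+-comm m 1) ⟩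
  fold a next (suc m)     ≡⟨ steps-around a ⟩
  a                       ∎
  where open ≡-Reasoning

next-injective : ∀ {m} → Injective _≡_ _≡_ (next {m})
next-injective {m} {a} {b} e = trans (sym (prev-next a)) (trans (cong prev e) (prev-next b))

return⇒∣ : ∀ {m} k (a : Fin (suc m)) → fold a next k ≡ a → suc m ∣ k
return⇒∣ {m} k a ret = divides ((toℕ a + k) / suc m) (NP.+-cancelˡ-≡ (toℕ a) _ _ (begin
  toℕ a + k                                          ≡⟨ m≡m%n+[m/n]*n (toℕ a + k) (suc m) ⟩
  (toℕ a + k) % suc m + (toℕ a + k) / suc m * suc m  ≡⟨ cong (_+ (toℕ a + k) / suc m * suc m) remainder ⟩
  toℕ a + (toℕ a + k) / suc m * suc m                ∎))
  where
  open ≡-Reasoning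
  remainder : (toℕ a + k) % suc m ≡ toℕ a
  remainder = trans (sym (toℕ-steps k a)) (cong toℕ ret)

steps-reach : ∀ {m} (a t : Fin (suc m)) → fold a next (suc m ∸ toℕ a + toℕ t) ≡ t
steps-reach {m} a t = FP.toℕ-injective (begin
  toℕ (fold a next (suc m ∸ toℕ a + toℕ t))   ≡⟨ toℕ-steps _ a ⟩
  (toℕ a + (suc m ∸ toℕ a + toℕ t)) % suc m   ≡⟨ cong (_% suc m) distance ⟩
  (toℕ t + suc m) % suc m                     ≡⟨ [m+n]%n≡m%n (toℕ t) (suc m) ⟩
  toℕ t % suc m                               ≡⟨ m<n⇒m%n≡m (FP.toℕ<n t) ⟩
  toℕ t                                       ∎)
  where
  open ≡-Reasoning
  distance : toℕ a + (suc m ∸ toℕ a + toℕ t) ≡ toℕ t + suc m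
  distance = begin
    toℕ a + (suc m ∸ toℕ a + toℕ t)   ≡⟨ NP.+-assoc (toℕ a) _ (toℕ t) ⟨
    toℕ a + (suc m ∸ toℕ a) + toℕ t   ≡⟨ cong (_+ toℕ t) (NP.m+[n∸m]≡n (NP.<⇒≤ (FP.toℕ<n a))) ⟩
    suc m + toℕ t                     ≡⟨ NP.+-comm (suc m) (toℕ t) ⟩
    toℕ t + suc m                     ∎

-- O_n for n ≥ 3 is a union of paths and cycles: a loop or a 2-cycle would be
-- a return after fewer than n steps.
circle-pathsAndCycles : ∀ m → 2 ≤ m → PathsAndCycles (circle m)
circle-pathsAndCycles m m≥2 = record
  { loopless   = λ a → BP.¬-not (λ e → >⇒∤ (s≤s (NP.≤-trans (s≤s z≤n) m≥2)) (return⇒∣ 1 a (sym (edge⇒next e))))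
  ; asymmetric = λ a b e₁ → BP.¬-not (λ e₂ → >⇒∤ (s≤s m≥2)
                   (return⇒∣ 2 a (sym (trans (edge⇒next e₂) (cong next (edge⇒next e₁))))))
  ; out≤1      = λ a b c e₁ e₂ → trans (edge⇒next e₁) (sym (edge⇒next e₂))
  ; in≤1       = λ a b c e₁ e₂ → next-injective (trans (sym (edge⇒next e₁)) (edge⇒next e₂))
  }
  where
  edge⇒next : ∀ {i j} → edge (circle m) i j ≡ true → j ≡ next i
  edge⇒next {i} {j} = to (circle-functional m i j)

-- Every cover of a circle that is a union of paths and cycles is the circle
-- plus an isolated vertex: a vertex w outside the circle cannot be adjacent
-- to it, as circle vertices already have in- and out-degree one.
circle-cover≅ : ∀ m Y → PathsAndCycles Y → Covers (circle m) Y → Y ≅ extend (circle m) (λ _ → false)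
circle-cover≅ m Y pc ((f , f-inj , f-edge) , Y⋢circle , between) with surjective⊎missing f
... | inj₁ onto = ⊥-elim (Y⋢circle (≅⇒⊒ {circle m} {Y} (surjective-⊑⇒≅ {circle m} {Y} (f , f-inj , f-edge) onto)))
... | inj₂ (w , missed) = ≅-trans {Y} {K} {extend (circle m) (λ _ → false)} (≅-sym {K} {Y} K≅Y) K≅extension
  where
  open PathsAndCycles pc
  g : Fin (suc (suc m)) → Vtx Y
  g fz     = w
  g (fs i) = f i
  g-inj : Injective _≡_ _≡_ g
  g-inj {fz}   {fz}   _ = refl
  g-inj {fz}   {fs j} e = ⊥-elim (missed j (sym e))
  g-inj {fs i} {fz}   e = ⊥-elim (missed i e)
  g-inj {fs i} {fs j} e = cong fs (f-inj e)
  K : Digraph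
  K = restrict Y g
  K≅Y : K ≅ Y
  K≅Y with between K (fs , FP.suc-injective , f-edge) (restrict-⊑ Y g g-inj)
  ... | inj₁ K⊑circle = ⊥-elim (NP.1+n≰n (⊑⇒size≤ {K} {circle m} K⊑circle))
  ... | inj₂ Y⊑K = ⊑-size⇒≅ {K} {Y} (restrict-⊑ Y g g-inj) (⊑⇒size≤ {Y} {K} Y⊑K)
  circle-edge : ∀ i j → edge (circle m) i j ≡ true → edge Y (f i) (f j) ≡ true
  circle-edge i j e = trans (sym (f-edge i j)) e
  K-edge : ∀ u v → edge K u v ≡ edge (extend (circle m) (λ _ → false)) u v
  K-edge fz fz = loopless w
  K-edge fz (fs j) = BP.¬-not λ e → missed (prev j)
    (in≤1 (f j) (f (prev j)) w (circle-edge (prev j) j (from (circle-functional m (prev j) j) (sym (next-prev j)))) e)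
  K-edge (fs i) fz = BP.¬-not λ e → missed (next i)
    (out≤1 (f i) (f (next i)) w (circle-edge i (next i) (from (circle-functional m i (next i)) refl)) e)
  K-edge (fs i) (fs j) = sym (f-edge i j)
  K≅extension : K ≅ extend (circle m) (λ _ → false)
  K≅extension = (λ x → x) , (λ x → x) , (λ _ → refl) , (λ _ → refl) , K-edge

circle-uniqueCover : ∀ m → UniqueCover (circle m)
circle-uniqueCover m Y Z pcY pcZ covY covZ =
  ≅-trans {Y} {extend (circle m) (λ _ → false)} {Z} (circle-cover≅ m Y pcY covY)
    (≅-sym {Z} {extend (circle m) (λ _ → false)} (circle-cover≅ m Z pcZ covZ))

-- A sinkless induced subgraph of a circle is the whole circle: following
-- out-edges from any vertex walks all the way around.
sinkless-⊑-circle⇒≅ : ∀ m Y → Y ⊑ circle m → Sinkless Y → Y ≅ circle m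
sinkless-⊑-circle⇒≅ m Y (f , f-inj , f-edge) sinkless = surjective-⊑⇒≅ {Y} {circle m} (f , f-inj , f-edge) onto
  where
  succ : Vtx Y → Vtx Y
  succ v = proj₁ (sinkless v)
  f-succ : ∀ v → f (succ v) ≡ next (f v)
  f-succ v = to (circle-functional m (f v) (f (succ v))) (trans (sym (f-edge v (succ v))) (proj₂ (sinkless v)))
  f-walk : ∀ k → f (fold fz succ k) ≡ fold (f fz) next k
  f-walk zero    = refl
  f-walk (suc k) = trans (f-succ (fold fz succ k)) (cong next (f-walk k))
  onto : ∀ t → ∃ λ x → f x ≡ t
  onto t = fold fz succ k , trans (f-walk k) (steps-reach (f fz) t)
    where
    k : ℕ
    k = suc m ∸ toℕ (f fz) + toℕ t

least : (P : ℕ → Set) → (∀ n → Dec (P n)) → ∀ n → P n → Σ ℕ λ p → P p × (∀ q → q < p → ¬ P q)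
least P P? zero    p = zero , p , λ _ ()
least P P? (suc n) p with P? zero
... | yes p₀ = zero , p₀ , λ _ ()
... | no ¬p₀ with least (P ∘ suc) (P? ∘ suc) n p
...   | q , pq , below = suc q , pq , λ { zero _ → ¬p₀ ; (suc r) r<q → below r (s<s⁻¹ r<q) }

-- In a sinkless union of paths and cycles, every vertex lies on a circle:
-- the out-neighbour function is injective, so the walk from vertex 0 returns
-- to 0, and the first return closes a circle of length at least 3.
module FirstReturn (G : Digraph) (pc : PathsAndCycles G) (sinkless : Sinkless G) where
  open PathsAndCycles pc

  succ : Vtx G → Vtx G
  succ v = proj₁ (sinkless v)

  functional : FunctionalVia G succ
  functional u v = mk⇔ (λ e → out≤1 u v (succ u) e (proj₂ (sinkless u)))
                       (λ { refl → proj₂ (sinkless u) })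

  succ-injective : Injective _≡_ _≡_ succ
  succ-injective {u} {u'} e =
    in≤1 (succ u) u u' (proj₂ (sinkless u)) (subst (λ x → edge G u' x ≡ true) (sym e) (proj₂ (sinkless u')))

  walk : ℕ → Vtx G
  walk = fold fz succ

  walk-cancel : ∀ a d → walk (a + d) ≡ walk a → walk d ≡ fz
  walk-cancel zero    d e = e
  walk-cancel (suc a) d e = walk-cancel a d (succ-injective e)

  -- By pigeonhole some vertex repeats, and cancelling the common prefix gives a
  -- return.  Kept abstract so that the period below is never unfolded.
  abstract
    returns : ∃ λ d → walk (suc d) ≡ fz
    returns with FP.pigeonhole (NP.n<1+n (suc (size G))) (walk ∘ toℕ)
    ... | i , j , i<j , repeat with NP.m≤n⇒∃[o]m+o≡n i<j
    ...   | d , i+1+d≡j = d , walk-cancel (toℕ i) (suc d)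
                               (trans (cong walk (trans (NP.+-suc (toℕ i) d) i+1+d≡j)) (sym repeat))

  firstReturn : Σ ℕ λ q → walk (suc q) ≡ fz × (∀ r → r < q → walk (suc r) ≢ fz)
  firstReturn = least (λ q → walk (suc q) ≡ fz) (λ q → walk (suc q) FP.≟ fz) (proj₁ returns) (proj₂ returns)

  -- the circle closed by the first return has suc q vertices
  q : ℕ
  q = proj₁ firstReturn

  closes : walk (suc q) ≡ fz
  closes = proj₁ (proj₂ firstReturn)

  no-repeat : ∀ {a b} → a < b → b ≤ q → walk b ≢ walk a
  no-repeat {a} a<b b≤q e with NP.m≤n⇒∃[o]m+o≡n a<b
  ... | d , refl = proj₂ (proj₂ firstReturn) d (NP.<-≤-trans (NP.m<n+m d {suc a} (s≤s z≤n)) b≤q)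
                     (walk-cancel a (suc d) (trans (cong walk (NP.+-suc a d)) e))

  walk-injective : ∀ a b → a ≤ q → b ≤ q → walk a ≡ walk b → a ≡ b
  walk-injective a b a≤q b≤q e with NP.<-cmp a b
  ... | tri< a<b _ _ = ⊥-elim (no-repeat a<b b≤q (sym e))
  ... | tri≈ _ a≡b _ = a≡b
  ... | tri> _ _ b<a = ⊥-elim (no-repeat b<a a≤q e)

  long : 2 ≤ q
  long = atLeast2 q closes
    where
    atLeast2 : ∀ r → walk (suc r) ≡ fz → 2 ≤ r
    atLeast2 zero e with () ← trans (sym (from (functional fz fz) (sym e))) (loopless fz)
    atLeast2 (suc zero) e with () ← trans (sym (from (functional (succ fz) fz) (sym e)))
                                          (asymmetric fz (succ fz) (from (functional fz (succ fz)) refl))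
    atLeast2 (suc (suc r)) _ = s≤s (s≤s z≤n)

  walk-step : ∀ (i : Fin (suc q)) → walk (toℕ (next i)) ≡ succ (walk (toℕ i))
  walk-step i with NP.m≤n⇒m<n∨m≡n (s≤s⁻¹ (FP.toℕ<n i))
  ... | inj₁ i<q = cong walk (trans (toℕ-next i) (m<n⇒m%n≡m (s≤s i<q)))
  ... | inj₂ i≡q = begin
    walk (toℕ (next i))  ≡⟨ cong walk (trans (toℕ-next i) (trans (cong (λ x → suc x % suc q) i≡q) (n%n≡0 (suc q)))) ⟩
    fz                   ≡⟨ closes ⟨
    walk (suc q)         ≡⟨ cong (walk ∘ suc) i≡q ⟨
    succ (walk (toℕ i))  ∎
    where open ≡-Reasoning

  circle⊑G : circle q ⊑ G
  circle⊑G = intertwining⇒⊑ (circle-functional q) functional (walk ∘ toℕ)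
    (λ {i} {j} e → FP.toℕ-injective (walk-injective (toℕ i) (toℕ j) (s≤s⁻¹ (FP.toℕ<n i)) (s≤s⁻¹ (FP.toℕ<n j)) e))
    walk-step

-- Abstract for the same reason: only the existence of the circle matters.
abstract
  sinkless⇒circle : ∀ G → PathsAndCycles G → Sinkless G → Σ ℕ λ q → 2 ≤ q × circle q ⊑ G
  sinkless⇒circle G pc sinkless = q , long , circle⊑G
    where open FirstReturn G pc sinkless

⋀ : ∀ {k n} m → (Fin m → Formula k n) → Formula k n
⋀ zero    _ = ¬' ⊥'
⋀ (suc m) φ = ∧' (φ fz) (⋀ m (φ ∘ fs))

sat-⋀ : ∀ {k n} {cs : Vec Digraph k} m (φ : Fin m → Formula k n) (ρ : Vec Digraph n) →
        Sat cs (⋀ m φ) ρ ⇔ (∀ j → Sat cs (φ j) ρ)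
sat-⋀ zero    φ ρ = mk⇔ (λ _ ()) (λ _ absurd → absurd)
sat-⋀ (suc m) φ ρ = mk⇔
  (λ { (first , rest) fz → first ; (first , rest) (fs j) → to (sat-⋀ m (φ ∘ fs) ρ) rest j })
  (λ all → all fz , from (sat-⋀ m (φ ∘ fs) ρ) (all ∘ fs))

_provided_ : ∀ {k n} {P : Set} → Formula k n → Dec P → Formula k n
φ provided yes _ = φ
φ provided no _  = ¬' ⊥'

sat-provided : ∀ {k n} {cs : Vec Digraph k} {P : Set} (φ : Formula k n) (P? : Dec P) (ρ : Vec Digraph n) →
               Sat cs (φ provided P?) ρ ⇔ (P → Sat cs φ ρ)
sat-provided φ (yes p) ρ = mk⇔ (λ s _ → s) (λ s → s p)
sat-provided φ (no ¬p) ρ = mk⇔ (λ _ p → ⊥-elim (¬p p)) (λ _ absurd → absurd)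

Sat* : ∀ {n} → Formula smallCount n → Vec Digraph n → Set
Sat* = Sat smallDigraphs

avoidF : ∀ {n} → Fin n → Fin smallCount → Formula smallCount n
avoidF i j = ¬' (⊑' (con j) (var i)) provided ¬? (pathsAndCycles? (lookup smallDigraphs j))

pathsAndCyclesF : ∀ {n} → Fin n → Formula smallCount n
pathsAndCyclesF i = ⋀ smallCount (avoidF i)

sat-pathsAndCyclesF : ∀ {n} (i : Fin n) (ρ : Vec Digraph n) → Sat* (pathsAndCyclesF i) ρ ⇔ PathsAndCycles (lookup ρ i)
sat-pathsAndCyclesF i ρ = mk⇔
  (λ s → from (pathsAndCycles⇔avoids (lookup ρ i)) λ j → to (sat-avoidF j) (to (sat-⋀ smallCount (avoidF i) ρ) s j))
  (λ pc → from (sat-⋀ smallCount (avoidF i) ρ) λ j → from (sat-avoidF j) (to (pathsAndCycles⇔avoids (lookup ρ i)) pc j))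
  where
  sat-avoidF : ∀ j → Sat* (avoidF i j) ρ ⇔
               (¬ PathsAndCycles (lookup smallDigraphs j) → ¬ (lookup smallDigraphs j ⊑ lookup ρ i))
  sat-avoidF j = sat-provided (¬' (⊑' (con j) (var i))) (¬? (pathsAndCycles? (lookup smallDigraphs j))) ρ

coversF : ∀ {n} → Fin n → Fin n → Formula smallCount n
coversF i j = ∧' (⊑' (var i) (var j)) (∧' (¬' (⊑' (var j) (var i)))
  (∀' (⇒' (⊑' (var (fs i)) (var fz)) (⇒' (⊑' (var fz) (var (fs j)))
         (∨' (⊑' (var fz) (var (fs i))) (⊑' (var (fs j)) (var fz)))))))

uniqueCoverF : ∀ {n} → Fin n → Formula smallCount n
uniqueCoverF i = ∀' (∀' (⇒' (pathsAndCyclesF 1F) (⇒' (pathsAndCyclesF 0F)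
  (⇒' (coversF (fs (fs i)) 1F) (⇒' (coversF (fs (fs i)) 0F) (≐' (var 1F) (var 0F)))))))

sat-uniqueCoverF : ∀ {n} (i : Fin n) (ρ : Vec Digraph n) → Sat* (uniqueCoverF i) ρ ⇔ UniqueCover (lookup ρ i)
sat-uniqueCoverF i ρ = mk⇔
  (λ s Y Z pcY pcZ → s Y Z (from (sat-pathsAndCyclesF 1F (Z ∷ Y ∷ ρ)) pcY) (from (sat-pathsAndCyclesF 0F (Z ∷ Y ∷ ρ)) pcZ))
  (λ unique Y Z sY sZ → unique Y Z (to (sat-pathsAndCyclesF 1F (Z ∷ Y ∷ ρ)) sY) (to (sat-pathsAndCyclesF 0F (Z ∷ Y ∷ ρ)) sZ))

CircleLike : Digraph → Set
CircleLike G = PathsAndCycles G × UniqueCover G × (∀ Y → Y ⊑ G → UniqueCover Y → Y ≅ G)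

circleF : Formula smallCount 1
circleF = ∧' (pathsAndCyclesF 0F) (∧' (uniqueCoverF 0F)
  (∀' (⇒' (⊑' (var 0F) (var 1F)) (⇒' (uniqueCoverF 0F) (≐' (var 0F) (var 1F))))))

sat-circleF : ∀ G → Sat* circleF (G ∷ []) ⇔ CircleLike G
sat-circleF G = mk⇔
  (λ (s₁ , s₂ , s₃) → to (sat-pathsAndCyclesF 0F (G ∷ [])) s₁ , to (sat-uniqueCoverF 0F (G ∷ [])) s₂ ,
                       λ Y Y⊑G unique → s₃ Y Y⊑G (from (sat-uniqueCoverF 0F (Y ∷ G ∷ [])) unique))
  (λ (pc , unique , minimal) → from (sat-pathsAndCyclesF 0F (G ∷ [])) pc , from (sat-uniqueCoverF 0F (G ∷ [])) unique ,
                       λ Y Y⊑G s → minimal Y Y⊑G (to (sat-uniqueCoverF 0F (Y ∷ G ∷ [])) s))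

-- A circle-like digraph contains a circle (it is sinkless), which also has a
-- unique cover and hence, by minimality, is the whole digraph.
circleLike⇒IsO : ∀ G → CircleLike G → IsO G
circleLike⇒IsO G (pc , unique , minimal) with sinkless⇒circle G pc (uniqueCover⇒sinkless G pc unique)
... | m , m≥2 , circle⊑G = m , m≥2 , ≅-sym {circle m} {G} (minimal (circle m) circle⊑G (circle-uniqueCover m))

-- A substructure of O_n with a unique cover is sinkless, hence all of O_n.
uniqueCover-⊑-circle⇒≅ : ∀ m → 2 ≤ m → ∀ Y → Y ⊑ circle m → UniqueCover Y → Y ≅ circle m
uniqueCover-⊑-circle⇒≅ m m≥2 Y Y⊑circle unique = sinkless-⊑-circle⇒≅ m Y Y⊑circle (uniqueCover⇒sinkless Y pcY unique)
  where
  pcY : PathsAndCycles Y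
  pcY = pathsAndCycles-⊑ {Y} {circle m} Y⊑circle (circle-pathsAndCycles m m≥2)

IsO⇒circleLike : ∀ G → IsO G → CircleLike G
IsO⇒circleLike G (m , m≥2 , G≅circle) =
  pathsAndCycles-⊑ {G} {circle m} G⊑circle (circle-pathsAndCycles m m≥2) ,
  uniqueCover-≅ {circle m} {G} circle≅G (circle-uniqueCover m) ,
  λ Y Y⊑G unique → ≅-trans {Y} {circle m} {G}
    (uniqueCover-⊑-circle⇒≅ m m≥2 Y (⊑-trans {Y} {G} {circle m} Y⊑G G⊑circle) unique) circle≅G
  where
  G⊑circle : G ⊑ circle m
  G⊑circle = ≅⇒⊑ {G} {circle m} G≅circle
  circle≅G : circle m ≅ G
  circle≅G = ≅-sym {G} {circle m} G≅circle

lemma3 : Σ ℕ λ k → Σ (Vec Digraph k) λ cs → Σ (Formula k 1) λ φ →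
           ∀ (G : Digraph) → (Sat cs φ (G ∷ []) ⇔ IsO G)
lemma3 = smallCount , smallDigraphs , circleF , λ G →
  ⇔-trans (sat-circleF G) (mk⇔ (circleLike⇒IsO G) (IsO⇒circleLike G))
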